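{- If $d$ and $e$ are degree sequences with a common sum and $d\succeq e$, then $\Delta_k(d)\le\Delta_k(e)$ for all $k\in\{1,\dots,m'\}$, where $m'=\min\{m(d),m(e)\}$.
   Context: Degree sequences are written in nonincreasing order (padded with zeros to a common length when compared). For degree sequences $d,e$ with the same sum, $d\succeq e$ ($d$ majorizes $e$) means $\sum_{i\le k}d_i\ge\sum_{i\le k}e_i$ for all $k$. $m(d)=\max\{i:d_i\ge i-1\}$ and $\Delta_k(d)=k(k-1)+\sum_{i>k}\min\{k,d_i\}-\sum_{i\le k}d_i$. -}

module Defs where

open import Data.Bool using (Bool; true; false; if_then_else_)
open import Data.Nat using (ℕ; zero; suc; _+_; _*_; _∸_; _≥_; _⊓_; _≤ᵇ_; pred)
open import Data.Fin using (Fin)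
open import Data.List using (List; []; _∷_; length; map; take; drop; allFin; lookup)
open import Data.Nat.ListAction using (sum)
open import Data.List.Relation.Unary.Linked using (Linked)
open import Data.Product using (Σ; _×_)
open import Data.Integer as ℤ using (ℤ; +_)
open import Relation.Binary.PropositionalEquality using (_≡_)

record SimpleGraph (n : ℕ) : Set where
  field
    adj   : Fin n → Fin n → Bool
    sym   : ∀ i j → adj i j ≡ adj j i
    irrefl : ∀ i → adj i i ≡ false

degree : ∀ {n} → SimpleGraph n → Fin n → ℕ
degree {n} G i = sum (map (λ j → if SimpleGraph.adj G i j then 1 else 0) (allFin n))

-- A degree sequence: a nonincreasing list d_1 ≥ d_2 ≥ … ≥ d_n which is the
-- degree sequence of some simple graph on n = length d vertices
-- (vertex i has degree d_{i+1}).
IsDegreeSequence : List ℕ → Set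
IsDegreeSequence d =
  Linked _≥_ d ×
  Σ (SimpleGraph (length d)) (λ G → ∀ i → degree G i ≡ lookup d i)

-- 1-based entry d_i, padded with zeros (d_0 is unused).
entry : List ℕ → ℕ → ℕ
entry []       _             = 0
entry (x ∷ xs) zero          = 0
entry (x ∷ xs) (suc zero)    = x
entry (x ∷ xs) (suc (suc i)) = entry xs (suc i)

-- d ⪰ e : equal sums and every prefix sum of d dominates that of e
-- (take k pads with zeros implicitly).
_⪰_ : List ℕ → List ℕ → Set
d ⪰ e = (sum d ≡ sum e) × (∀ k → sum (take k e) Data.Nat.≤ sum (take k d))

mUpTo : List ℕ → ℕ → ℕ
mUpTo d zero    = 0
mUpTo d (suc j) = if j ≤ᵇ entry d (suc j) then suc j else mUpTo d j

-- m(d) = max { i ≥ 1 : d_i ≥ i - 1 } for the zero-padded sequence;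
-- indices i ≥ length d + 2 never qualify, so searching up to length d + 1 is exact.
m : List ℕ → ℕ
m d = mUpTo d (suc (length d))

Δ : ℕ → List ℕ → ℤ
Δ k d = (+ (k * (k ∸ 1)) ℤ.+ + sum (map (k ⊓_) (drop k d))) ℤ.- + sum (take k d)

{-# OPTIONS --safe #-}
-- Write cₖ(x) for the sum of the first k entries and uₖ(x) = cₖ(x) + Σ_{i>k} (x_i ∸ k).
-- Since min{k, x_i} + (x_i ∸ k) = x_i, we get Δₖ(x) = k(k-1) + Σx − (cₖ(x) + uₖ(x)),
-- so it suffices that cₖ(e) ≤ cₖ(d), which is majorization at k, and uₖ(e) ≤ uₖ(d).
-- For every t, uₖ(x) ≥ c_{k+t}(x) − tk, with equality for nonincreasing x when t counts
-- the entries beyond position k that exceed k; so uₖ(e) = c_{k+t}(e) − tk ≤ c_{k+t}(d) − tk ≤ uₖ(d).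
module Submission where

open import Defs
open import Data.Nat using (ℕ; _≤_; _⊓_)
open import Data.List using (List)
open import Data.Integer using () renaming (_≤_ to _≤ℤ_)

open import Data.Nat using (zero; suc; _+_; _*_; _∸_; _≥_; _≤?_; z≤n)
open import Data.Nat.Properties
open import Data.Nat.ListAction using (sum)
open import Data.Nat.ListAction.Properties using (sum-++)
open import Data.List using ([]; _∷_; map; take; drop)
open import Data.List.Properties using (take++drop≡id; take-[])
open import Data.List.Relation.Unary.All using (All; []; _∷_) renaming (map to mapAll)
open import Data.List.Relation.Unary.AllPairs using (AllPairs; []; _∷_)
open import Data.List.Relation.Unary.AllPairs.Properties using (drop⁺)
open import Data.List.Relation.Unary.Linked.Properties using (Linked⇒AllPairs)
open import Data.Product using (∃; _,_)
open import Data.Integer as ℤ using (_⊖_)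
import Data.Integer.Properties as ℤₚ
open import Relation.Binary.PropositionalEquality
open import Relation.Nullary using (yes; no)
open import Function using (flip)
open import Algebra.Properties.CommutativeSemigroup +-commutativeSemigroup
  using (interchange; x∙yz≈y∙xz)

excess : ℕ → List ℕ → ℕ
excess k xs = sum (map (_∸ k) xs)

uncapped : ℕ → List ℕ → ℕ
uncapped k xs = sum (take k xs) + excess k (drop k xs)

sum-take+sum-drop : ∀ k (xs : List ℕ) → sum (take k xs) + sum (drop k xs) ≡ sum xs
sum-take+sum-drop k xs = trans (sym (sum-++ (take k xs) (drop k xs)))
                               (cong sum (take++drop≡id k xs))

sum-take-+ : ∀ k t (xs : List ℕ) →
  sum (take (k + t) xs) ≡ sum (take k xs) + sum (take t (drop k xs))
sum-take-+ zero    t xs       = refl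
sum-take-+ (suc k) t []       = cong sum (sym (take-[] t))
sum-take-+ (suc k) t (x ∷ xs) = trans (cong (x +_) (sum-take-+ k t xs)) (sym (+-assoc x _ _))

sum-⊓+excess : ∀ k (xs : List ℕ) → sum (map (k ⊓_) xs) + excess k xs ≡ sum xs
sum-⊓+excess k []       = refl
sum-⊓+excess k (x ∷ xs) = begin
  (k ⊓ x + sum (map (k ⊓_) xs)) + ((x ∸ k) + excess k xs)
    ≡⟨ interchange (k ⊓ x) _ _ _ ⟩
  (k ⊓ x + (x ∸ k)) + (sum (map (k ⊓_) xs) + excess k xs)
    ≡⟨ cong₂ _+_ (m⊓n+n∸m≡n k x) (sum-⊓+excess k xs) ⟩
  x + sum xs ∎
  where open ≡-Reasoning

sum-capped+uncapped : ∀ k (xs : List ℕ) →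
  sum (map (k ⊓_) (drop k xs)) + uncapped k xs ≡ sum xs
sum-capped+uncapped k xs = begin
  b + (c + excess k (drop k xs)) ≡⟨ x∙yz≈y∙xz b c _ ⟩
  c + (b + excess k (drop k xs)) ≡⟨ cong (c +_) (sum-⊓+excess k (drop k xs)) ⟩
  c + sum (drop k xs)            ≡⟨ sum-take+sum-drop k xs ⟩
  sum xs                         ∎
  where
  open ≡-Reasoning
  b = sum (map (k ⊓_) (drop k xs))
  c = sum (take k xs)

excess-≡0 : ∀ {k} {xs : List ℕ} → All (_≤ k) xs → excess k xs ≡ 0
excess-≡0 []           = refl
excess-≡0 (x≤k ∷ xs≤k) = cong₂ _+_ (m≤n⇒m∸n≡0 x≤k) (excess-≡0 xs≤k)

sum-take≤*+excess : ∀ k t (xs : List ℕ) → sum (take t xs) ≤ t * k + excess k xs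
sum-take≤*+excess k t       []       = ≤-trans (≤-reflexive (cong sum (take-[] t))) z≤n
sum-take≤*+excess k zero    (x ∷ xs) = z≤n
sum-take≤*+excess k (suc t) (x ∷ xs) = begin
  x + sum (take t xs)                       ≤⟨ +-mono-≤ (m≤n+m∸n x k) (sum-take≤*+excess k t xs) ⟩
  (k + (x ∸ k)) + (t * k + excess k xs)     ≡⟨ interchange k (x ∸ k) (t * k) _ ⟩
  (k + t * k) + ((x ∸ k) + excess k xs)     ∎
  where open ≤-Reasoning

*+excess≤sum-take : ∀ k {xs : List ℕ} → AllPairs _≥_ xs →
  ∃ λ t → t * k + excess k xs ≤ sum (take t xs)
*+excess≤sum-take k [] = 0 , z≤n
*+excess≤sum-take k {x ∷ xs} (x≥xs ∷ xs↓) with x ≤? k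
... | yes x≤k = 0 , ≤-reflexive (excess-≡0 (x≤k ∷ mapAll (λ y≤x → ≤-trans y≤x x≤k) x≥xs))
... | no x≰k with *+excess≤sum-take k xs↓
... | t , bound = suc t , (begin
  (k + t * k) + ((x ∸ k) + excess k xs)     ≡⟨ interchange k (t * k) (x ∸ k) _ ⟩
  (k + (x ∸ k)) + (t * k + excess k xs)     ≤⟨ +-mono-≤ (≤-reflexive (m+[n∸m]≡n (≰⇒≥ x≰k))) bound ⟩
  x + sum (take t xs)                       ∎)
  where open ≤-Reasoning

uncapped-mono : ∀ k {d e : List ℕ} → AllPairs _≥_ e →
  (∀ j → sum (take j e) ≤ sum (take j d)) → uncapped k e ≤ uncapped k d
uncapped-mono k {d} {e} e↓ prefix≤ with *+excess≤sum-take k (drop⁺ k e↓)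
... | t , bound = +-cancelˡ-≤ (t * k) _ _ (begin
  t * k + (sum (take k e) + excess k (drop k e))   ≡⟨ x∙yz≈y∙xz (t * k) (sum (take k e)) _ ⟩
  sum (take k e) + (t * k + excess k (drop k e))   ≤⟨ +-monoʳ-≤ (sum (take k e)) bound ⟩
  sum (take k e) + sum (take t (drop k e))         ≡⟨ sum-take-+ k t e ⟨
  sum (take (k + t) e)                             ≤⟨ prefix≤ (k + t) ⟩
  sum (take (k + t) d)                             ≡⟨ sum-take-+ k t d ⟩
  sum (take k d) + sum (take t (drop k d))         ≤⟨ +-monoʳ-≤ (sum (take k d)) (sum-take≤*+excess k t (drop k d)) ⟩
  sum (take k d) + (t * k + excess k (drop k d))   ≡⟨ x∙yz≈y∙xz (sum (take k d)) (t * k) _ ⟩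
  t * k + (sum (take k d) + excess k (drop k d))   ∎)
  where open ≤-Reasoning

Δ≡⊖ : ∀ k (xs : List ℕ) →
  Δ k xs ≡ (k * (k ∸ 1) + sum xs) ⊖ (sum (take k xs) + uncapped k xs)
Δ≡⊖ k xs = begin
  (ℤ.+ K ℤ.+ ℤ.+ b) ℤ.- ℤ.+ c   ≡⟨ cong (ℤ._- ℤ.+ c) (ℤₚ.pos-+ K b) ⟨
  ℤ.+ (K + b) ℤ.- ℤ.+ c         ≡⟨ ℤₚ.[+m]-[+n]≡m⊖n (K + b) c ⟩
  (K + b) ⊖ c                   ≡⟨ ℤₚ.+-cancelˡ-⊖ u (K + b) c ⟨
  (u + (K + b)) ⊖ (u + c)       ≡⟨ cong₂ _⊖_ u+K+b≡K+sum (+-comm u c) ⟩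
  (K + sum xs) ⊖ (c + u)        ∎
  where
  open ≡-Reasoning
  K = k * (k ∸ 1)
  b = sum (map (k ⊓_) (drop k xs))
  c = sum (take k xs)
  u = uncapped k xs
  u+K+b≡K+sum : u + (K + b) ≡ K + sum xs
  u+K+b≡K+sum = trans (x∙yz≈y∙xz u K b) (cong (K +_) (trans (+-comm u b) (sum-capped+uncapped k xs)))

theorem4p7 : (d e : List ℕ) → IsDegreeSequence d → IsDegreeSequence e →
    d ⪰ e → (k : ℕ) → 1 ≤ k → k ≤ m d ⊓ m e → Δ k d ≤ℤ Δ k e
theorem4p7 d e _ (e↓ , _) (sum≡ , prefix≤) k _ _ = begin
  Δ k d                                                  ≡⟨ Δ≡⊖ k d ⟩
  (K + sum d) ⊖ (sum (take k d) + uncapped k d)          ≤⟨ ℤₚ.⊖-monoʳ-≥-≤ (K + sum d) subtrahend≤ ⟩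
  (K + sum d) ⊖ (sum (take k e) + uncapped k e)          ≡⟨ cong (λ s → (K + s) ⊖ (sum (take k e) + uncapped k e)) sum≡ ⟩
  (K + sum e) ⊖ (sum (take k e) + uncapped k e)          ≡⟨ Δ≡⊖ k e ⟨
  Δ k e                                                  ∎
  where
  open ℤₚ.≤-Reasoning
  K = k * (k ∸ 1)
  subtrahend≤ : sum (take k e) + uncapped k e ≤ sum (take k d) + uncapped k d
  subtrahend≤ = +-mono-≤ (prefix≤ k) (uncapped-mono k (Linked⇒AllPairs (flip ≤-trans) e↓) prefix≤)
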